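{- Let $G=S_{m_1}^-\square\cdots\square S_{m_p}^-\square S_{n_1}^+\square\cdots\square S_{n_q}^+$ with a $c$-coloring $c$. For a vertex $v=(a_1,\dots,a_p,b_1,\dots,b_q)$ of $G$ let $f(v)=(y,x)$, where $y$ is the number of nonzero entries among $a_1,\dots,a_p$ and $x$ is the number of zero entries among $b_1,\dots,b_q$. Let $I=\{v\in V(G): x+y \text{ is even, where } f(v)=(y,x)\}$. Then $G$ has an up-color kernel if and only if $I$ is up-color absorbent.
   Context: $S_k^+$ is the orientation of the star $K_{1,k}$ in which all arcs go from the center to the leaves, and $S_k^-$ the orientation in which all arcs go from the leaves to the center. In each star the center is labeled $0$ and the leaves $1,\dots,k$, so vertices of the product are tuples of labels. The Cartesian product $D_1\square D_2$ has vertex set $V(D_1)\times V(D_2)$ and an arc from $(v_1,v_1')$ to $(v_2,v_2')$ iff either $v_1=v_2$ and $(v_1',v_2')\in A(D_2)$, or $v_1'=v_2'$ and $(v_1,v_2)\in A(D_1)$ (iterated products defined coordinatewise in the same way). A $c$-coloring is a function $c:V(G)\to\{0,1,2,\ldots\}$. A set $N$ is up-color absorbent if every vertex $v\notin N$ has an out-neighbor $w\in N$ with $c(v)<c(w)$, and no vertex of $N$ has color $0$; an up-color kernel is an independent up-color absorbent set. -}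

module Defs where

open import Data.Nat using (ℕ; zero; suc; _+_; _<_; _≡ᵇ_; _%_)
open import Data.Fin using (Fin; zero; suc)
open import Data.Bool using (Bool; true; false; not)
open import Data.Product using (Σ; _×_; _,_; ∃)
open import Data.Sum using (_⊎_)
open import Relation.Binary.PropositionalEquality using (_≡_; _≢_)

-- Stars. A star with k leaves has vertex labels Fin (suc k): zero is the
-- center, suc _ are the leaves.
isLeaf : ∀ {k} → Fin (suc k) → Bool
isLeaf zero    = false
isLeaf (suc _) = true

isCenter : ∀ {k} → Fin (suc k) → Bool
isCenter u = not (isLeaf u)

ArcPlus : ∀ {k} → Fin (suc k) → Fin (suc k) → Set
ArcPlus u v = (isCenter u ≡ true) × (isLeaf v ≡ true)

ArcMinus : ∀ {k} → Fin (suc k) → Fin (suc k) → Set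
ArcMinus u v = (isLeaf u ≡ true) × (isCenter v ≡ true)

record Vertex (p q : ℕ) (ms : Fin p → ℕ) (ns : Fin q → ℕ) : Set where
  constructor vtx
  field
    as : (i : Fin p) → Fin (suc (ms i))
    bs : (j : Fin q) → Fin (suc (ns j))
open Vertex public

module _ {p q : ℕ} {ms : Fin p → ℕ} {ns : Fin q → ℕ} where

  V : Set
  V = Vertex p q ms ns

  Arc : V → V → Set
  Arc u v =
      (Σ (Fin p) λ i → ArcMinus (as u i) (as v i)
          × (∀ i' → i' ≢ i → as u i' ≡ as v i')
          × (∀ j → bs u j ≡ bs v j))
    ⊎ (Σ (Fin q) λ j → ArcPlus (bs u j) (bs v j)
          × (∀ i → as u i ≡ as v i)
          × (∀ j' → j' ≢ j → bs u j' ≡ bs v j'))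

  -- A vertex set is a Boolean characteristic function (G is finite).
  VSet : Set
  VSet = V → Bool

  UpColorAbsorbent : (V → ℕ) → VSet → Set
  UpColorAbsorbent c N =
      (∀ v → N v ≡ false → ∃ λ w → Arc v w × N w ≡ true × c v < c w)
    × (∀ v → N v ≡ true → c v ≢ 0)

  Independent : VSet → Set
  Independent N = ∀ u v → N u ≡ true → N v ≡ true → Arc u v → Data.Empty.⊥
    where import Data.Empty

  UpColorKernel : (V → ℕ) → VSet → Set
  UpColorKernel c N = Independent N × UpColorAbsorbent c N

  HasUpColorKernel : (V → ℕ) → Set
  HasUpColorKernel c = ∃ λ N → UpColorKernel c N

countTrue : ∀ {n} → (Fin n → Bool) → ℕ
countTrue {zero}  P = 0
countTrue {suc n} P with P zero
... | true  = suc (countTrue (λ i → P (suc i)))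
... | false = countTrue (λ i → P (suc i))

fy : ∀ {p q ms ns} → Vertex p q ms ns → ℕ
fy v = countTrue (λ i → isLeaf (as v i))

fx : ∀ {p q ms ns} → Vertex p q ms ns → ℕ
fx v = countTrue (λ j → isCenter (bs v j))

Iset : ∀ {p q ms ns} → Vertex p q ms ns → Bool
Iset v = ((fx v + fy v) % 2) ≡ᵇ 0

-- Let rank v = x + y for f(v) = (y, x). Every arc of G moves one coordinate a_i from a leaf
-- to the centre or one coordinate b_j from the centre to a leaf, so it lowers the rank by
-- exactly one, and every vertex of positive rank has an out-arc. In such a graded digraph an
-- independent absorbing set N is forced, by induction on the rank, to be the set of vertices
-- of even rank: a sink must lie in N, a vertex outside N has an out-neighbour in N one rank
-- lower, and a vertex in N has some out-neighbour one rank lower, which is outside N. That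
-- set is I, and I is independent because arcs change the parity of the rank.
module Submission where

open import Defs
open import Data.Nat using (ℕ; zero; suc; _+_; _≤_; _%_; _≡ᵇ_; s≤s)
open import Data.Nat.Properties using (+-suc)
import Data.Nat.Properties as ℕ
open import Data.Fin using (Fin; zero; suc; _≟_)
open import Data.Fin.Properties using (any?; suc-injective)
open import Data.Bool using (Bool; true; false; not)
import Data.Bool as Bool
open import Data.Bool.Properties using (not-injective; not-¬; ¬-not)
open import Data.Product using (Σ; _×_; _,_; ∃)
open import Data.Sum using (inj₁; inj₂)
open import Data.Empty using (⊥)
open import Relation.Nullary using (¬_; yes; no; contradiction)
open import Relation.Binary.PropositionalEquality
open import Function.Base using (_∘_)
open import Function.Bundles using (_⇔_; mk⇔)

isEven : ℕ → Bool
isEven n = n % 2 ≡ᵇ 0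

isEven-suc : ∀ n → isEven (suc n) ≡ not (isEven n)
isEven-suc zero          = refl
isEven-suc (suc zero)    = refl
isEven-suc (suc (suc n)) = isEven-suc n

countTrue-cong : ∀ {n} {P Q : Fin n → Bool} → (∀ i → P i ≡ Q i) → countTrue P ≡ countTrue Q
countTrue-cong {zero}          _   = refl
countTrue-cong {suc n} {P} {Q} P≗Q rewrite P≗Q zero with Q zero
... | true  = cong suc (countTrue-cong (λ i → P≗Q (suc i)))
... | false = countTrue-cong (λ i → P≗Q (suc i))

countTrue-flip : ∀ {n} {P Q : Fin n → Bool} (i : Fin n) → P i ≡ true → Q i ≡ false →
                 (∀ i' → i' ≢ i → P i' ≡ Q i') → countTrue P ≡ suc (countTrue Q)
countTrue-flip {suc n} {P} {Q} zero Pi Qi P≗Q rewrite Pi | Qi =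
  cong suc (countTrue-cong (λ i' → P≗Q (suc i') λ ()))
countTrue-flip {suc n} {P} {Q} (suc i) Pi Qi P≗Q
  with countTrue-flip i Pi Qi (λ i' i'≢i → P≗Q (suc i') (i'≢i ∘ suc-injective))
... | tail-flip rewrite P≗Q zero (λ ()) with Q zero
... | true  = cong suc tail-flip
... | false = tail-flip

countTrue-≡0 : ∀ {n} {P : Fin n → Bool} → ¬ (∃ λ i → P i ≡ true) → countTrue P ≡ 0
countTrue-≡0 {zero}      _    = refl
countTrue-≡0 {suc n} {P} none with P zero in P₀
... | true  = contradiction (zero , P₀) none
... | false = countTrue-≡0 λ (i , Pi) → none (suc i , Pi)

module GradedDigraph {V : Set} (_⇒_ : V → V → Set) (rank : V → ℕ)
  (⇒-rank : ∀ {v w} → v ⇒ w → rank v ≡ suc (rank w))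
  (rank-suc⇒out : ∀ {v k} → rank v ≡ suc k → ∃ λ w → v ⇒ w) where

  evenRank : V → Bool
  evenRank v = isEven (rank v)

  ⇒-flips-evenRank : ∀ {v w} → v ⇒ w → evenRank v ≡ not (evenRank w)
  ⇒-flips-evenRank {w = w} v⇒w = trans (cong isEven (⇒-rank v⇒w)) (isEven-suc (rank w))

  ⇒-rank-pred : ∀ {v w k} → v ⇒ w → rank v ≡ suc k → rank w ≡ k
  ⇒-rank-pred v⇒w rank-v = ℕ.suc-injective (trans (sym (⇒-rank v⇒w)) rank-v)

  evenRank-independent : ∀ u v → evenRank u ≡ true → evenRank v ≡ true → u ⇒ v → ⊥
  evenRank-independent u v even-u even-v u⇒v =
    not-¬ refl (trans (sym even-u) (trans (⇒-flips-evenRank u⇒v) (cong not even-v)))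

  module _ (N : V → Bool)
    (independent : ∀ u v → N u ≡ true → N v ≡ true → u ⇒ v → ⊥)
    (absorbing : ∀ v → N v ≡ false → ∃ λ w → v ⇒ w × N w ≡ true) where

    private
      kernel-at-rank : ∀ n v → rank v ≡ n → N v ≡ isEven n
      kernel-at-rank zero v rank-v with N v in Nv
      ... | true  = refl
      ... | false with absorbing v Nv
      ... | w , v⇒w , _ with () ← trans (sym rank-v) (⇒-rank v⇒w)
      kernel-at-rank (suc k) v rank-v rewrite isEven-suc k with N v in Nv
      ... | true  with rank-suc⇒out rank-v
      ... | w , v⇒w = cong not (trans (sym Nw) (kernel-at-rank k w (⇒-rank-pred v⇒w rank-v)))
        where
        Nw : N w ≡ false
        Nw = ¬-not λ Nw → independent v w Nv Nw v⇒w
      kernel-at-rank (suc k) v rank-v | false with absorbing v Nv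
      ... | w , v⇒w , Nw = cong not (trans (sym Nw) (kernel-at-rank k w (⇒-rank-pred v⇒w rank-v)))

    kernel≗evenRank : ∀ v → N v ≡ evenRank v
    kernel≗evenRank v = kernel-at-rank (rank v) v refl

update : ∀ {n} {F : Fin n → Set} → (∀ i → F i) → (i : Fin n) → F i → ∀ i' → F i'
update f i x i' with i' ≟ i
... | yes refl = x
... | no _     = f i'

update-≡ : ∀ {n} {F : Fin n → Set} (f : ∀ i → F i) (i : Fin n) (x : F i) → update f i x i ≡ x
update-≡ f i x with i ≟ i
... | yes refl = refl
... | no i≢i   = contradiction refl i≢i

update-≢ : ∀ {n} {F : Fin n → Set} (f : ∀ i → F i) {i i' : Fin n} (x : F i) →
           i' ≢ i → update f i x i' ≡ f i'
update-≢ f {i} {i'} x i'≢i with i' ≟ i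
... | yes i'≡i = contradiction i'≡i i'≢i
... | no _     = refl

leafOf : ∀ {k} → 1 ≤ k → Σ (Fin (suc k)) λ ℓ → isLeaf ℓ ≡ true
leafOf (s≤s _) = suc zero , refl

module _ {p q : ℕ} {ms : Fin p → ℕ} {ns : Fin q → ℕ} where

  rank : Vertex p q ms ns → ℕ
  rank v = fx v + fy v

  Arc⇒rank-suc : ∀ {v w : Vertex p q ms ns} → Arc v w → rank v ≡ suc (rank w)
  Arc⇒rank-suc {v} {w} (inj₁ (i , (leaf , centre) , as≗ , bs≗)) = begin
    fx v + fy v        ≡⟨ cong₂ _+_ fx≡ fy≡ ⟩
    fx w + suc (fy w)  ≡⟨ +-suc (fx w) (fy w) ⟩
    suc (rank w)       ∎
    where
    open ≡-Reasoning
    fx≡ : fx v ≡ fx w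
    fx≡ = countTrue-cong (λ j → cong isCenter (bs≗ j))
    fy≡ : fy v ≡ suc (fy w)
    fy≡ = countTrue-flip i leaf (not-injective centre) (λ i' i'≢i → cong isLeaf (as≗ i' i'≢i))
  Arc⇒rank-suc {v} {w} (inj₂ (j , (centre , leaf) , as≗ , bs≗)) = cong₂ _+_ fx≡ fy≡
    where
    fx≡ : fx v ≡ suc (fx w)
    fx≡ = countTrue-flip j centre (cong not leaf) (λ j' j'≢j → cong isCenter (bs≗ j' j'≢j))
    fy≡ : fy v ≡ fy w
    fy≡ = countTrue-cong (λ i → cong isLeaf (as≗ i))

  leafToCentre : (v : Vertex p q ms ns) (i : Fin p) → isLeaf (as v i) ≡ true →
                 Arc v (vtx (update (as v) i zero) (bs v))
  leafToCentre v i leaf =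
    inj₁ (i , (leaf , cong isCenter (update-≡ (as v) i zero))
            , (λ i' i'≢i → sym (update-≢ (as v) zero i'≢i))
            , (λ _ → refl))

  centreToLeaf : (v : Vertex p q ms ns) (j : Fin q) {ℓ : Fin (suc (ns j))} →
                 isCenter (bs v j) ≡ true → isLeaf ℓ ≡ true →
                 Arc v (vtx (as v) (update (bs v) j ℓ))
  centreToLeaf v j {ℓ} centre leaf =
    inj₂ (j , (centre , trans (cong isLeaf (update-≡ (bs v) j ℓ)) leaf)
            , (λ _ → refl)
            , (λ j' j'≢j → sym (update-≢ (bs v) ℓ j'≢j)))

  rank-suc⇒Arc : (∀ j → 1 ≤ ns j) → ∀ {v k} → rank v ≡ suc k → ∃ λ w → Arc v w
  rank-suc⇒Arc ns≥1 {v} rank-v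
    with any? (λ i → isLeaf (as v i) Bool.≟ true) | any? (λ j → isCenter (bs v j) Bool.≟ true)
  ... | yes (i , leaf) | _                 = _ , leafToCentre v i leaf
  ... | no _           | yes (j , centre)  = let _ , leaf = leafOf (ns≥1 j) in _ , centreToLeaf v j centre leaf
  ... | no noLeaf      | no noCentre
    with () ← trans (sym rank-v) (cong₂ _+_ (countTrue-≡0 noCentre) (countTrue-≡0 noLeaf))

UpColorAbsorbent-cong : ∀ {p q ms ns} {c : Vertex p q ms ns → ℕ} {N M : VSet} →
                        (∀ v → N v ≡ M v) → UpColorAbsorbent c N → UpColorAbsorbent c M
UpColorAbsorbent-cong N≗M (absorbs , nonzero) =
    (λ v Mv → let w , v⇒w , Nw , c< = absorbs v (trans (N≗M v) Mv)
              in  w , v⇒w , trans (sym (N≗M w)) Nw , c<)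
  , (λ v Mv → nonzero v (trans (N≗M v) Mv))

mainTheorem6 : (p q : ℕ) (ms : Fin p → ℕ) (ns : Fin q → ℕ)
    → (∀ i → 1 ≤ ms i) → (∀ j → 1 ≤ ns j)
    → (c : Vertex p q ms ns → ℕ)
    → HasUpColorKernel c ⇔ UpColorAbsorbent c Iset
mainTheorem6 p q ms ns _ ns≥1 c =
  mk⇔ kernel⇒I-absorbent (λ I-absorbent → Iset , evenRank-independent , I-absorbent)
  where
  open GradedDigraph (Arc {p} {q} {ms} {ns}) rank Arc⇒rank-suc (rank-suc⇒Arc ns≥1)

  kernel⇒I-absorbent : HasUpColorKernel c → UpColorAbsorbent c Iset
  kernel⇒I-absorbent (N , independent , absorbent@(absorbs , _)) =
    UpColorAbsorbent-cong (kernel≗evenRank N independent absorbing) absorbent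
    where
    absorbing : ∀ v → N v ≡ false → ∃ λ w → Arc v w × N w ≡ true
    absorbing v Nv = let w , v⇒w , Nw , _ = absorbs v Nv in w , v⇒w , Nw
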